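{- For every $n\ge 1$, the diameter of the Cayley graph $H_n$ is at least $n2^{n-1}$.
   Context: Let $S_{2^n}$ be the symmetric group on $\{0,1,\dots,2^n-1\}$. For $v$ in this set and $j\in\{0,\dots,n-1\}$, $v\oplus 2^j$ is $v$ with bit $j$ of its binary expansion flipped. Let $C_H=\{(v\ \ v\oplus 2^j): v\in\{0,\dots,2^n-1\},\ j\in\{0,\dots,n-1\}\}$ (the permutations realized by a single multiple-control Toffoli gate whose $n-1$ non-target lines are all positive or negative controls). The Cayley graph $H_n$ has vertex set $S_{2^n}$, with $g,h$ adjacent iff $h=c\circ g$ for some $c\in C_H$. The diameter is the largest shortest-path distance between two vertices. -}

module Defs where

open import Data.Nat using (ℕ; suc; _*_; _^_; _∸_; _<_; _≥_)
open import Data.Bool using (Bool; not) renaming (_≟_ to _≟ᵇ_)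
open import Data.Fin using (Fin)
open import Data.Vec using (Vec; updateAt)
open import Data.Vec.Properties using (≡-dec)
open import Data.List using (List; []; _∷_; length)
open import Data.Product using (_×_; _,_; Σ-syntax)
open import Relation.Nullary using (yes; no; ¬_)
open import Relation.Binary.PropositionalEquality using (_≡_; _≗_)
open import Function using (_∘_; _↔_; Inverse)

-- Points {0,…,2^n-1} are identified with their binary expansions:
-- a vector b of n bits, where  lookup b j  is bit j  (so v = Σ_j b_j 2^j).
Point : ℕ → Set
Point n = Vec Bool n

-- v ⊕ 2^j : flip bit j of v.
flipBit : ∀ {n} → Point n → Fin n → Point n
flipBit v j = updateAt v j not

_≟ᵖ_ : ∀ {n} (x y : Point n) → Relation.Nullary.Dec (x ≡ y)
_≟ᵖ_ = ≡-dec _≟ᵇ_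

transp : ∀ {n} → Point n → Point n → Point n → Point n
transp a b x with x ≟ᵖ a
... | yes _ = b
... | no _ with x ≟ᵖ b
...   | yes _ = a
...   | no _  = x

-- A generator in C_H is determined by (v , j): the transposition (v  v ⊕ 2^j).
Gen : ℕ → Set
Gen n = Point n × Fin n

genFun : ∀ {n} → Gen n → Point n → Point n
genFun (v , j) = transp v (flipBit v j)

-- Elements of S_{2^n}: bijections of the point set.
Perm : ℕ → Set
Perm n = Point n ↔ Point n

applyGens : ∀ {n} → List (Gen n) → Point n → Point n
applyGens []       x = x
applyGens (c ∷ cs) x = applyGens cs (genFun c x)

-- h is reached from g by a walk in H_n using the generator sequence cs:
-- h = c_k ∘ … ∘ c₁ ∘ g  (equality of permutations = pointwise equality)
WalkTo : ∀ {n} → Perm n → Perm n → List (Gen n) → Set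
WalkTo g h cs = Inverse.to h ≗ (applyGens cs ∘ Inverse.to g)

DistAtLeast : ∀ {n} → Perm n → Perm n → ℕ → Set
DistAtLeast g h d = ∀ cs → length cs < d → ¬ WalkTo g h cs

DiameterAtLeast : ℕ → ℕ → Set
DiameterAtLeast n d = Σ[ g ∈ Perm n ] Σ[ h ∈ Perm n ] DistAtLeast g h d

module Submission where

-- For a permutation F of the cube {0,1}^n, its total displacement
--   Φ(F) = Σ_x ham(F x, x)
-- sums the Hamming distances by which F moves the points.  Composing F with
-- a transposition (a b) changes only the two points sent to a and b, each of
-- which moves by at most ham(a,b) (triangle inequality); so Φ grows by at most
-- 2·ham(a,b).  A generator of H_n swaps two points at Hamming distance 1, hence
-- every edge of H_n changes Φ by at most 2.  The identity has Φ = 0, while the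
-- complement map x ↦ x̄ moves every one of the 2^n points by n, so Φ = n·2^n.
-- Any walk from the identity to the complement therefore has length at least
-- n·2^n / 2 = n·2^(n-1).

open import Defs
open import Data.Nat using (ℕ; zero; suc; _+_; _*_; _^_; _∸_; _≤_; _≥_; z≤n; s≤s)
open import Data.Nat.Properties
open import Data.Bool using (Bool; true; false; not) renaming (_≟_ to _≟ᵇ_)
open import Data.Fin using (Fin) renaming (zero to fzero; suc to fsuc)
open import Data.Vec using ([]; _∷_) renaming (map to vmap)
open import Data.Vec.Properties using (∷-injective)
open import Data.List using (List; []; _∷_; _++_; length) renaming (map to lmap)
open import Data.Product using (_,_; uncurry)
open import Relation.Nullary using (Dec; yes; no; ¬_)
open import Relation.Nullary.Decidable using (_×-dec_)
open import Relation.Binary.PropositionalEquality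
open import Function using (_∘_; Inverse)
open import Function.Bundles using (mk↔ₛ′)
open import Function.Construct.Identity using (↔-id)
open import Function.Construct.Composition using (_↔-∘_)
open import Data.Empty using (⊥-elim)
import Algebra.Properties.CommutativeSemigroup +-commutativeSemigroup as +-CS
import Algebra.Properties.CommutativeSemigroup *-commutativeSemigroup as *-CS

𝟙 : ∀ {P : Set} → Dec P → ℕ
𝟙 (yes _) = 1
𝟙 (no _)  = 0

𝟙-cong : ∀ {P Q : Set} → (P → Q) → (Q → P) → (d : Dec P) (e : Dec Q) → 𝟙 d ≡ 𝟙 e
𝟙-cong _   _   (yes _) (yes _) = refl
𝟙-cong P⇒Q _   (yes p) (no ¬q) = ⊥-elim (¬q (P⇒Q p))
𝟙-cong _   Q⇒P (no ¬p) (yes q) = ⊥-elim (¬p (Q⇒P q))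
𝟙-cong _   _   (no _)  (no _)  = refl

𝟙-× : ∀ {P Q : Set} (d : Dec P) (e : Dec Q) → 𝟙 (d ×-dec e) ≡ 𝟙 d * 𝟙 e
𝟙-× (yes _) (yes _) = refl
𝟙-× (yes _) (no _)  = refl
𝟙-× (no _)  _       = refl

sumOver : ∀ {A : Set} → List A → (A → ℕ) → ℕ
sumOver []       f = 0
sumOver (x ∷ xs) f = f x + sumOver xs f

syntax sumOver L (λ x → e) = ∑[ x ∈ L ] e

sum-cong : ∀ {A : Set} {f g : A → ℕ} → (∀ x → f x ≡ g x) → ∀ L → sumOver L f ≡ sumOver L g
sum-cong f≗g []       = refl
sum-cong f≗g (x ∷ xs) = cong₂ _+_ (f≗g x) (sum-cong f≗g xs)

sum-mono : ∀ {A : Set} {f g : A → ℕ} → (∀ x → f x ≤ g x) → ∀ L → sumOver L f ≤ sumOver L g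
sum-mono f≤g []       = z≤n
sum-mono f≤g (x ∷ xs) = +-mono-≤ (f≤g x) (sum-mono f≤g xs)

sum-+ : ∀ {A : Set} (f g : A → ℕ) L → ∑[ x ∈ L ] (f x + g x) ≡ sumOver L f + sumOver L g
sum-+ f g []       = refl
sum-+ f g (x ∷ xs) = trans (cong (f x + g x +_) (sum-+ f g xs)) (+-CS.interchange (f x) (g x) _ _)

sum-*ˡ : ∀ {A : Set} (c : ℕ) (f : A → ℕ) L → ∑[ x ∈ L ] (c * f x) ≡ c * sumOver L f
sum-*ˡ c f []       = sym (*-zeroʳ c)
sum-*ˡ c f (x ∷ xs) = trans (cong (c * f x +_) (sum-*ˡ c f xs)) (sym (*-distribˡ-+ c (f x) _))

sum-*ʳ : ∀ {A : Set} (c : ℕ) (f : A → ℕ) L → ∑[ x ∈ L ] (f x * c) ≡ sumOver L f * c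
sum-*ʳ c f L = trans (sum-cong (λ x → *-comm (f x) c) L) (trans (sum-*ˡ c f L) (*-comm c _))

sum-++ : ∀ {A : Set} (f : A → ℕ) L M → sumOver (L ++ M) f ≡ sumOver L f + sumOver M f
sum-++ f []       M = refl
sum-++ f (x ∷ xs) M = trans (cong (f x +_) (sum-++ f xs M)) (sym (+-assoc (f x) _ _))

sum-map : ∀ {A B : Set} (f : B → ℕ) (g : A → B) L → sumOver (lmap g L) f ≡ sumOver L (f ∘ g)
sum-map f g []       = refl
sum-map f g (x ∷ xs) = cong (f (g x) +_) (sum-map f g xs)

points : ∀ n → List (Point n)
points zero    = [] ∷ []
points (suc n) = lmap (true ∷_) (points n) ++ lmap (false ∷_) (points n)

sum-points-suc : ∀ n (f : Point (suc n) → ℕ) →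
  sumOver (points (suc n)) f ≡ ∑[ x ∈ points n ] f (true ∷ x) + ∑[ x ∈ points n ] f (false ∷ x)
sum-points-suc n f = trans (sum-++ f (lmap (true ∷_) (points n)) _)
                           (cong₂ _+_ (sum-map f (true ∷_) (points n)) (sum-map f (false ∷_) (points n)))

sum-points-const : ∀ n (f : Point n → ℕ) c → (∀ x → f x ≡ c) → sumOver (points n) f ≡ c * 2 ^ n
sum-points-const zero    f c f≡c = trans (+-identityʳ (f [])) (trans (f≡c []) (sym (*-identityʳ c)))
sum-points-const (suc n) f c f≡c = begin
  sumOver (points (suc n)) f                                       ≡⟨ sum-points-suc n f ⟩
  ∑[ x ∈ points n ] f (true ∷ x) + ∑[ x ∈ points n ] f (false ∷ x) ≡⟨ cong₂ _+_ (half true) (half false) ⟩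
  c * 2 ^ n + c * 2 ^ n                                            ≡⟨ cong (λ t → c * 2 ^ n + c * t) (+-identityʳ (2 ^ n)) ⟨
  c * 2 ^ n + c * (2 ^ n + 0)                                      ≡⟨ *-distribˡ-+ c (2 ^ n) (2 ^ n + 0) ⟨
  c * 2 ^ suc n                                                    ∎
  where
  open ≡-Reasoning
  half : ∀ b → ∑[ x ∈ points n ] f (b ∷ x) ≡ c * 2 ^ n
  half b = sum-points-const n (f ∘ (b ∷_)) c (λ x → f≡c (b ∷ x))

𝟙-≟-∷ : ∀ {n} b c (x y : Point n) → 𝟙 ((b ∷ x) ≟ᵖ (c ∷ y)) ≡ 𝟙 (b ≟ᵇ c) * 𝟙 (x ≟ᵖ y)
𝟙-≟-∷ b c x y = trans (𝟙-cong ∷-injective (uncurry (cong₂ _∷_)) _ ((b ≟ᵇ c) ×-dec (x ≟ᵖ y)))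
                      (𝟙-× (b ≟ᵇ c) (x ≟ᵖ y))

count-points : ∀ n (p : Point n) → ∑[ x ∈ points n ] 𝟙 (x ≟ᵖ p) ≡ 1
count-points zero    []      = refl
count-points (suc n) (b ∷ p) = begin
  ∑[ x ∈ points (suc n) ] 𝟙 (x ≟ᵖ (b ∷ p))                  ≡⟨ sum-points-suc n _ ⟩
  occurrences true + occurrences false                      ≡⟨ cong₂ _+_ (with-head true) (with-head false) ⟩
  𝟙 (true ≟ᵇ b) * 1 + 𝟙 (false ≟ᵇ b) * 1                    ≡⟨ exactly-one b ⟩
  1                                                         ∎
  where
  open ≡-Reasoning
  occurrences : Bool → ℕ
  occurrences c = ∑[ x ∈ points n ] 𝟙 ((c ∷ x) ≟ᵖ (b ∷ p))
  with-head : ∀ c → occurrences c ≡ 𝟙 (c ≟ᵇ b) * 1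
  with-head c = begin
    occurrences c                                  ≡⟨ sum-cong (λ x → 𝟙-≟-∷ c b x p) (points n) ⟩
    ∑[ x ∈ points n ] (𝟙 (c ≟ᵇ b) * 𝟙 (x ≟ᵖ p))    ≡⟨ sum-*ˡ (𝟙 (c ≟ᵇ b)) _ (points n) ⟩
    𝟙 (c ≟ᵇ b) * ∑[ x ∈ points n ] 𝟙 (x ≟ᵖ p)      ≡⟨ cong (𝟙 (c ≟ᵇ b) *_) (count-points n p) ⟩
    𝟙 (c ≟ᵇ b) * 1                                 ∎
  exactly-one : ∀ b → 𝟙 (true ≟ᵇ b) * 1 + 𝟙 (false ≟ᵇ b) * 1 ≡ 1
  exactly-one true  = refl
  exactly-one false = refl

count-preimage : ∀ {n} (g : Perm n) (p : Point n) → ∑[ x ∈ points n ] 𝟙 (Inverse.to g x ≟ᵖ p) ≡ 1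
count-preimage {n} g p =
  trans (sum-cong (λ x → 𝟙-cong to⇒from from⇒to (to x ≟ᵖ p) (x ≟ᵖ from p)) (points n))
        (count-points n (from p))
  where
  open Inverse g
  to⇒from : ∀ {x} → to x ≡ p → x ≡ from p
  to⇒from {x} e = trans (sym (strictlyInverseʳ x)) (cong from e)
  from⇒to : ∀ {x} → x ≡ from p → to x ≡ p
  from⇒to e = trans (cong to e) (strictlyInverseˡ p)

bitDist : Bool → Bool → ℕ
bitDist true  true  = 0
bitDist false false = 0
bitDist true  false = 1
bitDist false true  = 1

ham : ∀ {n} → Point n → Point n → ℕ
ham []       []       = 0
ham (b ∷ x) (c ∷ y)  = bitDist b c + ham x y

bitDist-refl : ∀ b → bitDist b b ≡ 0
bitDist-refl true  = refl
bitDist-refl false = refl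

bitDist-sym : ∀ b c → bitDist b c ≡ bitDist c b
bitDist-sym true  true  = refl
bitDist-sym true  false = refl
bitDist-sym false true  = refl
bitDist-sym false false = refl

bitDist-triangle : ∀ a b c → bitDist a c ≤ bitDist a b + bitDist b c
bitDist-triangle true  true  true  = z≤n
bitDist-triangle true  true  false = s≤s z≤n
bitDist-triangle true  false true  = z≤n
bitDist-triangle true  false false = s≤s z≤n
bitDist-triangle false true  true  = s≤s z≤n
bitDist-triangle false true  false = z≤n
bitDist-triangle false false true  = s≤s z≤n
bitDist-triangle false false false = z≤n

ham-refl : ∀ {n} (x : Point n) → ham x x ≡ 0
ham-refl []      = refl
ham-refl (b ∷ x) = cong₂ _+_ (bitDist-refl b) (ham-refl x)

ham-sym : ∀ {n} (x y : Point n) → ham x y ≡ ham y x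
ham-sym []      []      = refl
ham-sym (b ∷ x) (c ∷ y) = cong₂ _+_ (bitDist-sym b c) (ham-sym x y)

ham-triangle : ∀ {n} (x y z : Point n) → ham x z ≤ ham x y + ham y z
ham-triangle []      []      []      = z≤n
ham-triangle (a ∷ x) (b ∷ y) (c ∷ z) =
  ≤-trans (+-mono-≤ (bitDist-triangle a b c) (ham-triangle x y z))
          (≤-reflexive (+-CS.interchange (bitDist a b) (bitDist b c) (ham x y) (ham y z)))

ham-complement : ∀ {n} (x : Point n) → ham (vmap not x) x ≡ n
ham-complement []          = refl
ham-complement (true ∷ x)  = cong suc (ham-complement x)
ham-complement (false ∷ x) = cong suc (ham-complement x)

ham-flipBit : ∀ {n} (v : Point n) (j : Fin n) → ham v (flipBit v j) ≡ 1
ham-flipBit (true ∷ v)  fzero    = cong suc (ham-refl v)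
ham-flipBit (false ∷ v) fzero    = cong suc (ham-refl v)
ham-flipBit (b ∷ v)     (fsuc j) = cong₂ _+_ (bitDist-refl b) (ham-flipBit v j)

moved : ∀ {n} → Point n → Point n → Point n → ℕ
moved a b y = 𝟙 (y ≟ᵖ a) + 𝟙 (y ≟ᵖ b)

transp-displacement : ∀ {n} (a b y x : Point n) →
  ham (transp a b y) x ≤ ham y x + moved a b y * ham a b
transp-displacement a b y x with y ≟ᵖ a
... | yes refl = begin
  ham b x                           ≤⟨ ham-triangle b y x ⟩
  ham b y + ham y x                 ≡⟨ cong (_+ ham y x) (ham-sym b y) ⟩
  ham y b + ham y x                 ≡⟨ +-comm (ham y b) _ ⟩
  ham y x + ham y b                 ≤⟨ +-monoʳ-≤ (ham y x) (m≤m+n (ham y b) _) ⟩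
  ham y x + (ham y b + 𝟙 (y ≟ᵖ b) * ham y b) ∎
  where open ≤-Reasoning
... | no _ with y ≟ᵖ b
...   | yes refl = begin
  ham a x                           ≤⟨ ham-triangle a y x ⟩
  ham a y + ham y x                 ≡⟨ +-comm (ham a y) _ ⟩
  ham y x + ham a y                 ≡⟨ cong (ham y x +_) (+-identityʳ (ham a y)) ⟨
  ham y x + (ham a y + 0)           ∎
  where open ≤-Reasoning
...   | no _ = m≤m+n (ham y x) 0

transp-at-a : ∀ {n} (a b : Point n) → transp a b a ≡ b
transp-at-a a b with a ≟ᵖ a
... | yes _  = refl
... | no a≢a = ⊥-elim (a≢a refl)

transp-at-b : ∀ {n} (a b : Point n) → transp a b b ≡ a
transp-at-b a b with b ≟ᵖ a
... | yes b≡a = b≡a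
... | no _ with b ≟ᵖ b
...   | yes _  = refl
...   | no b≢b = ⊥-elim (b≢b refl)

transp-elsewhere : ∀ {n} (a b x : Point n) → ¬ x ≡ a → ¬ x ≡ b → transp a b x ≡ x
transp-elsewhere a b x x≢a x≢b with x ≟ᵖ a
... | yes x≡a = ⊥-elim (x≢a x≡a)
... | no _ with x ≟ᵖ b
...   | yes x≡b = ⊥-elim (x≢b x≡b)
...   | no _    = refl

transp-involutive : ∀ {n} (a b x : Point n) → transp a b (transp a b x) ≡ x
transp-involutive a b x with x ≟ᵖ a
... | yes refl = transp-at-b x b
... | no x≢a with x ≟ᵖ b
...   | yes refl = transp-at-a a x
...   | no x≢b   = transp-elsewhere a b x x≢a x≢b

transpPerm : ∀ {n} → Point n → Point n → Perm n
transpPerm a b = mk↔ₛ′ (transp a b) (transp a b) (transp-involutive a b) (transp-involutive a b)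

Φ : ∀ {n} → (Point n → Point n) → ℕ
Φ {n} F = ∑[ x ∈ points n ] ham (F x) x

-- Composing a permutation with (a b) raises Φ by at most 2·ham(a,b):
-- exactly one point is sent to a and one to b.
Φ-transp : ∀ {n} (a b : Point n) (g : Perm n) →
  Φ (transp a b ∘ Inverse.to g) ≤ Φ (Inverse.to g) + 2 * ham a b
Φ-transp {n} a b g = begin
  Φ (transp a b ∘ to)                                             ≤⟨ sum-mono (λ x → transp-displacement a b (to x) x) (points n) ⟩
  ∑[ x ∈ points n ] (ham (to x) x + moved a b (to x) * ham a b)   ≡⟨ sum-+ _ _ (points n) ⟩
  Φ to + ∑[ x ∈ points n ] (moved a b (to x) * ham a b)           ≡⟨ cong (Φ to +_) (sum-*ʳ (ham a b) _ (points n)) ⟩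
  Φ to + (∑[ x ∈ points n ] moved a b (to x)) * ham a b           ≡⟨ cong (λ k → Φ to + k * ham a b) moved-total ⟩
  Φ to + 2 * ham a b                                              ∎
  where
  open Inverse g
  open ≤-Reasoning
  moved-total : ∑[ x ∈ points n ] moved a b (to x) ≡ 2
  moved-total = trans (sum-+ _ _ (points n)) (cong₂ _+_ (count-preimage g a) (count-preimage g b))

Φ-applyGens : ∀ {n} (cs : List (Gen n)) (g : Perm n) →
  Φ (applyGens cs ∘ Inverse.to g) ≤ Φ (Inverse.to g) + 2 * length cs
Φ-applyGens []              g = m≤m+n _ 0
Φ-applyGens ((v , j) ∷ cs) g = begin
  Φ (applyGens cs ∘ Inverse.to g′)                      ≤⟨ Φ-applyGens cs g′ ⟩
  Φ (genFun (v , j) ∘ Inverse.to g) + 2 * length cs     ≤⟨ +-monoˡ-≤ (2 * length cs) (Φ-transp v (flipBit v j) g) ⟩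
  Φ (Inverse.to g) + 2 * ham v (flipBit v j) + 2 * length cs ≡⟨ cong (λ d → Φ (Inverse.to g) + 2 * d + 2 * length cs) (ham-flipBit v j) ⟩
  Φ (Inverse.to g) + 2 + 2 * length cs                  ≡⟨ +-assoc (Φ (Inverse.to g)) 2 _ ⟩
  Φ (Inverse.to g) + (2 + 2 * length cs)                ≡⟨ cong (Φ (Inverse.to g) +_) (*-suc 2 (length cs)) ⟨
  Φ (Inverse.to g) + 2 * suc (length cs)                ∎
  where
  open ≤-Reasoning
  g′ : Perm _
  g′ = transpPerm v (flipBit v j) ↔-∘ g

Φ-walk : ∀ {n} (g h : Perm n) (cs : List (Gen n)) → WalkTo g h cs →
  Φ (Inverse.to h) ≤ Φ (Inverse.to g) + 2 * length cs
Φ-walk {n} g h cs walk =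
  ≤-trans (≤-reflexive (sum-cong (λ x → cong (λ y → ham y x) (walk x)) (points n))) (Φ-applyGens cs g)

complement-involutive : ∀ {n} (x : Point n) → vmap not (vmap not x) ≡ x
complement-involutive []          = refl
complement-involutive (true ∷ x)  = cong (true ∷_) (complement-involutive x)
complement-involutive (false ∷ x) = cong (false ∷_) (complement-involutive x)

complementPerm : ∀ n → Perm n
complementPerm n = mk↔ₛ′ (vmap not) (vmap not) complement-involutive complement-involutive

complement-distance : ∀ n (cs : List (Gen n)) → WalkTo (↔-id (Point n)) (complementPerm n) cs → n * 2 ^ n ≤ 2 * length cs
complement-distance n cs walk = begin
  n * 2 ^ n                                  ≡⟨ sum-points-const n _ n ham-complement ⟨
  Φ {n} (vmap not)                           ≤⟨ Φ-walk (↔-id (Point n)) (complementPerm n) cs walk ⟩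
  Φ {n} (λ x → x) + 2 * length cs            ≡⟨ cong (_+ 2 * length cs) (sum-points-const n _ 0 ham-refl) ⟩
  2 * length cs                              ∎
  where open ≤-Reasoning

mainTheorem9 : ∀ (n : ℕ) → n ≥ 1 → DiameterAtLeast n (n * 2 ^ (n ∸ 1))
mainTheorem9 (suc m) _ = ↔-id (Point (suc m)) , complementPerm (suc m) , too-short
  where
  too-short : DistAtLeast (↔-id (Point (suc m))) (complementPerm (suc m)) (suc m * 2 ^ m)
  too-short cs short walk = <⇒≱ (begin-strict
    2 * length cs           <⟨ *-monoʳ-< 2 short ⟩
    2 * (suc m * 2 ^ m)     ≡⟨ *-CS.x∙yz≈y∙xz 2 (suc m) (2 ^ m) ⟩
    suc m * 2 ^ suc m       ∎) (complement-distance (suc m) cs walk)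
    where open ≤-Reasoning
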